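{- For any integers $n, m \geq 2$, the super edge-magic deficiency of $K_{1,n} + \overline{K_m}$ satisfies \[\left\lceil \tfrac{1}{2}(n-1)(m-1)\right\rceil \leq \mu_s(K_{1,n} + \overline{K_m}) \leq n(m-1)-1.\]
   Context: All graphs are finite and simple. For a graph $G$ with $p=|V(G)|$ vertices and $q=|E(G)|$ edges, a super edge-magic labeling is a bijection $f: V(G)\cup E(G)\to\{1,2,\ldots,p+q\}$ with $f(V(G))=\{1,\ldots,p\}$ such that $f(x)+f(xy)+f(y)$ is the same constant for every edge $xy$; $G$ is super edge-magic if it has such a labeling. The super edge-magic deficiency $\mu_s(G)$ is the minimum nonnegative integer $t$ such that $G\cup tK_1$ (disjoint union of $G$ with $t$ isolated vertices) is super edge-magic, or $+\infty$ if no such $t$ exists. The join $G_1+G_2$ of two vertex-disjoint graphs is their union together with all edges joining a vertex of $G_1$ to a vertex of $G_2$. $K_{1,n}$ is the star with center $c$ and leaves $x_1,\ldots,x_n$, and $\overline{K_m}$ is the graph with $m$ vertices $y_1,\ldots,y_m$ and no edges; so $K_{1,n}+\overline{K_m}$ has edges $cx_i$, $x_iy_j$ and $cy_j$ for $1\le i\le n$, $1\le j\le m$. -}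

module Defs where

open import Data.Nat using (ℕ; zero; suc; _+_; _*_; _∸_; _≤_; _<_; _/_)
open import Data.Fin using (Fin; _↑ˡ_; _↑ʳ_) renaming (zero to fzero; suc to fsuc)
open import Data.List using (List; length; map; _++_; concatMap; lookup; allFin)
open import Data.Product using (_×_; _,_; ∃; Σ; proj₁; proj₂; map₁; map₂)
open import Data.Sum using (_⊎_; inj₁; inj₂)
open import Relation.Binary.PropositionalEquality using (_≡_)
open import Relation.Nullary using (¬_)
open import Function.Definitions using (Injective)

record Graph : Set where
  constructor mkGraph
  field
    p     : ℕ
    edges : List (Fin p × Fin p)

  q : ℕ
  q = length edges

  edge : Fin q → Fin p × Fin p
  edge = lookup edges

open Graph public

record IsSuperEdgeMagic (G : Graph) (f : Fin (p G) ⊎ Fin (q G) → ℕ) : Set where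
  field
    injective   : Injective _≡_ _≡_ f
    inRange     : ∀ z → 1 ≤ f z × f z ≤ p G + q G
    onto        : ∀ k → 1 ≤ k → k ≤ p G + q G → ∃ λ z → f z ≡ k
    vertexRange : ∀ v → f (inj₁ v) ≤ p G
    vertexOnto  : ∀ k → 1 ≤ k → k ≤ p G → ∃ λ v → f (inj₁ v) ≡ k
    magic       : ∃ λ c → ∀ (e : Fin (q G)) →
                    f (inj₁ (proj₁ (edge G e))) + f (inj₂ e) + f (inj₁ (proj₂ (edge G e))) ≡ c

SuperEdgeMagic : Graph → Set
SuperEdgeMagic G = ∃ λ (f : Fin (p G) ⊎ Fin (q G) → ℕ) → IsSuperEdgeMagic G f

_∪K₁[_] : Graph → ℕ → Graph
G ∪K₁[ t ] = mkGraph (p G + t) (map (λ e → proj₁ e ↑ˡ t , proj₂ e ↑ˡ t) (edges G))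

-- μ_s(G) = min { t | G ∪ tK₁ is super edge-magic } (or +∞).
-- "μ_s(G) ≤ u" unfolds to: some t ≤ u makes G ∪ tK₁ super edge-magic.
μs≤ : Graph → ℕ → Set
μs≤ G u = ∃ λ t → t ≤ u × SuperEdgeMagic (G ∪K₁[ t ])

-- "l ≤ μ_s(G)" unfolds to: no t < l makes G ∪ tK₁ super edge-magic.
≤μs : ℕ → Graph → Set
≤μs l G = ∀ t → t < l → ¬ SuperEdgeMagic (G ∪K₁[ t ])

-- K_{1,n} + \overline{K_m}: vertices Fin (1 + (n + m)):
-- c = 0, x_i = 1 + i (i < n), y_j = 1 + n + j (j < m).
K1n+Km : ℕ → ℕ → Graph
K1n+Km n m = mkGraph (suc (n + m))
  (map (λ i → c , x i) (allFin n)
   ++ concatMap (λ i → map (λ j → x i , y j) (allFin m)) (allFin n)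
   ++ map (λ j → c , y j) (allFin m))
  where
    c : Fin (suc (n + m))
    c = fzero
    x : Fin n → Fin (suc (n + m))
    x i = fsuc (i ↑ˡ m)
    y : Fin m → Fin (suc (n + m))
    y j = fsuc (n ↑ʳ j)

ceilHalf : ℕ → ℕ
ceilHalf a = (a + 1) / 2

-- Lower bound: in a super edge-magic labelling of G ∪ tK₁ the q = nm + n + m edges have pairwise
-- distinct vertex-label sums lying in [3, 2p − 1], where p = n + m + 1 + t; hence q ≤ 2p − 3,
-- i.e. (n − 1)(m − 1) ≤ 2t.
-- Upper bound: a graph is super edge-magic as soon as its vertices can be labelled 1 … p so that
-- the edge sums are q consecutive integers. For t = n(m − 1) − 1 such a labelling is read off an
-- m × (n + 1) grid whose cells are the labels.
module Submission where

open import Defs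
open import Data.Nat using (ℕ; zero; suc; _+_; _*_; _∸_; _≤_; _<_; _/_; _%_; z≤n; s≤s; NonZero; _≤?_)
open import Data.Nat.Properties
open import Data.Nat.DivMod using (m≡m%n+[m/n]*n; m%n<n; [m+kn]%n≡m%n; m<n⇒m%n≡m; m<n*o⇒m/o<n; %-congˡ)
open import Data.Nat.Tactic.RingSolver using (solve-∀)
open import Data.Fin using (Fin; toℕ; fromℕ<; splitAt; punchOut; _↑ˡ_; _↑ʳ_) renaming (zero to fzero; suc to fsuc)
open import Data.Fin.Properties
  using (toℕ<n; toℕ-fromℕ<; toℕ-injective; splitAt-↑ˡ; splitAt-↑ʳ; ↑ˡ-injective; punchOut-injective; injective⇒≤; any?)
  renaming (_≟_ to _≟ᶠ_; suc-injective to fsuc-injective)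
open import Data.List using (List; []; _∷_; length; map; concatMap; allFin)
open import Data.List.Properties using (length-map; length-++; length-tabulate)
open import Data.List.Membership.Propositional using (_∈_)
open import Data.List.Membership.Propositional.Properties
  using (∈-lookup; ∈-allFin; ∈-map⁺; ∈-map⁻; ∈-++⁺ˡ; ∈-++⁺ʳ; ∈-++⁻; ∈-concat⁺′; ∈-concat⁻′)
open import Data.List.Relation.Unary.Any using (index)
open import Data.List.Relation.Unary.Any.Properties using (lookup-index)
open import Data.Product using (_×_; _,_; ∃; ∃₂; proj₁; proj₂)
open import Data.Sum using (_⊎_; inj₁; inj₂; [_,_]′)
open import Data.Sum.Properties using (inj₁-injective; inj₂-injective)
open import Relation.Binary.PropositionalEquality
open import Relation.Nullary using (yes; no)
open import Relation.Binary.Definitions using (tri<; tri≈; tri>)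
open import Data.Empty using (⊥-elim)
open import Function.Definitions using (Injective)

injective⇒onto : ∀ {k} (f : Fin k → Fin k) → Injective _≡_ _≡_ f → ∀ y → ∃ λ x → f x ≡ y
injective⇒onto {suc k} f f-inj y with any? (λ x → f x ≟ᶠ y)
... | yes hit = hit
... | no miss = ⊥-elim (1+n≰n (injective⇒≤ f′-inj))
  where
    f≢y : ∀ x → y ≢ f x
    f≢y x eq = miss (x , sym eq)
    f′ : Fin (suc k) → Fin k
    f′ x = punchOut (f≢y x)
    f′-inj : Injective _≡_ _≡_ f′
    f′-inj eq = f-inj (punchOut-injective (f≢y _) (f≢y _) eq)

-- A section of h is an injective endomap of Fin k, hence onto, so h is its inverse.
hits⇒injective : ∀ {k} (h : Fin k → ℕ) → (∀ x → x < k → ∃ λ i → h i ≡ x) → Injective _≡_ _≡_ h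
hits⇒injective {k} h hits {i} {j} hi≡hj =
  from-sections hi≡hj (injective⇒onto section section-inj i) (injective⇒onto section section-inj j)
  where
    section : Fin k → Fin k
    section x = proj₁ (hits (toℕ x) (toℕ<n x))
    h∘section : ∀ x → h (section x) ≡ toℕ x
    h∘section x = proj₂ (hits (toℕ x) (toℕ<n x))
    section-inj : Injective _≡_ _≡_ section
    section-inj {x} {y} eq = toℕ-injective (trans (sym (h∘section x)) (trans (cong h eq) (h∘section y)))
    from-sections : ∀ {i j} → h i ≡ h j → ∃ (λ x → section x ≡ i) → ∃ (λ y → section y ≡ j) → i ≡ j
    from-sections eq (x , refl) (y , refl) =
      cong section (toℕ-injective (trans (sym (h∘section x)) (trans eq (h∘section y))))

bounded-injective⇒≤ : ∀ {k N} (h : Fin k → ℕ) → (∀ i → h i < N) → Injective _≡_ _≡_ h → k ≤ N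
bounded-injective⇒≤ h h<N h-inj = injective⇒≤ {f = λ i → fromℕ< (h<N i)} λ {i} {j} eq →
  h-inj (trans (sym (toℕ-fromℕ< (h<N i))) (trans (cong toℕ eq) (toℕ-fromℕ< (h<N j))))

record Enumerates {k : ℕ} (a : ℕ) (h : Fin k → ℕ) : Set where
  field
    bounded : ∀ i → a ≤ h i × h i < a + k
    hits    : ∀ x → a ≤ x → x < a + k → ∃ λ i → h i ≡ x

  injective : Injective _≡_ _≡_ h
  injective eq = hits⇒injective (λ i → h i ∸ a) hits-shifted (cong (_∸ a) eq)
    where
      hits-shifted : ∀ x → x < k → ∃ λ i → h i ∸ a ≡ x
      hits-shifted x x<k with hits (a + x) (m≤m+n a x) (+-monoʳ-< a x<k)
      ... | i , hi≡a+x = i , trans (cong (_∸ a) hi≡a+x) (m+n∸m≡n a x)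

pairSum : ∀ {V : Set} → (V → ℕ) → V × V → ℕ
pairSum ℓ uv = ℓ (proj₁ uv) + ℓ (proj₂ uv)

edgeSum : (G : Graph) → (Fin (p G) → ℕ) → Fin (q G) → ℕ
edgeSum G ℓ e = pairSum ℓ (edge G e)

∈-edges⇒edge : ∀ G {uv} → uv ∈ edges G → ∃ λ e → edge G e ≡ uv
∈-edges⇒edge G uv∈ = index uv∈ , sym (lookup-index uv∈)

module _ (a P Q : ℕ) where

  private
    K≡a+Q+P : a + (P + Q) ≡ a + Q + P
    K≡a+Q+P = trans (cong (a +_) (+-comm P Q)) (sym (+-assoc a Q P))

  complement-bounds : ∀ {s} → a ≤ s → s < a + Q → P < a + (P + Q) ∸ s × a + (P + Q) ∸ s ≤ P + Q
  complement-bounds {s} a≤s s<a+Q =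
    subst (_< K ∸ s) K∸[a+Q]≡P (∸-monoʳ-< s<a+Q (subst (a + Q ≤_) (sym K≡a+Q+P) (m≤m+n (a + Q) P))) ,
    subst (K ∸ s ≤_) (m+n∸m≡n a (P + Q)) (∸-monoʳ-≤ K a≤s)
    where
      K = a + (P + Q)
      K∸[a+Q]≡P : K ∸ (a + Q) ≡ P
      K∸[a+Q]≡P = trans (cong (_∸ (a + Q)) K≡a+Q+P) (m+n∸m≡n (a + Q) P)

  complement-bounds⁻ : ∀ {k} → P < k → k ≤ P + Q → a ≤ a + (P + Q) ∸ k × a + (P + Q) ∸ k < a + Q
  complement-bounds⁻ {k} P<k k≤P+Q =
    subst (_≤ K ∸ k) (m+n∸n≡m a (P + Q)) (∸-monoʳ-≤ K k≤P+Q) ,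
    subst (K ∸ k <_) K∸P≡a+Q (∸-monoʳ-< P<k (≤-trans k≤P+Q (m≤n+m (P + Q) a)))
    where
      K = a + (P + Q)
      K∸P≡a+Q : K ∸ P ≡ a + Q
      K∸P≡a+Q = trans (cong (_∸ P) K≡a+Q+P) (m+n∸n≡m (a + Q) P)

magic-sum : ∀ x y {K} → x + y ≤ K → suc x + (K ∸ (x + y)) + suc y ≡ 2 + K
magic-sum x y {K} x+y≤K = begin
  suc x + (K ∸ (x + y)) + suc y   ≡⟨ rearrange x y (K ∸ (x + y)) ⟩
  2 + (K ∸ (x + y) + (x + y))     ≡⟨ cong (2 +_) (m∸n+n≡m x+y≤K) ⟩
  2 + K                           ∎
  where
    open ≡-Reasoning
    rearrange : ∀ x y z → suc x + z + suc y ≡ 2 + (z + (x + y))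
    rearrange = solve-∀

-- The criterion of Figueroa-Centeno et al.: label vertices by 1 + ℓ and the edge uv by K ∸ (ℓ u + ℓ v),
-- where K = a + (p + q) reflects the sums [a, a + q) onto the edge labels (p, p + q].
consecutive-edgeSums⇒superEdgeMagic : ∀ G (ℓ : Fin (p G) → ℕ) a →
  Enumerates 0 ℓ → Enumerates a (edgeSum G ℓ) → SuperEdgeMagic G
consecutive-edgeSums⇒superEdgeMagic G ℓ a ℓ-enum s-enum = f , record
  { injective   = f-injective
  ; inRange     = λ { (inj₁ v) → s≤s z≤n , ≤-trans (ℓ<p v) (m≤m+n P Q)
                    ; (inj₂ e) → ≤-trans (s≤s z≤n) (proj₁ (label-bounds e)) , proj₂ (label-bounds e) }
  ; onto        = onto
  ; vertexRange = ℓ<p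
  ; vertexOnto  = vertexOnto
  ; magic       = 2 + K , λ e → magic-sum (ℓ (proj₁ (edge G e))) (ℓ (proj₂ (edge G e))) (s≤K e)
  }
  where
    module ℓ = Enumerates ℓ-enum
    module s = Enumerates s-enum
    P = p G
    Q = q G
    s = edgeSum G ℓ
    K = a + (P + Q)

    f : Fin P ⊎ Fin Q → ℕ
    f (inj₁ v) = suc (ℓ v)
    f (inj₂ e) = K ∸ s e

    ℓ<p : ∀ v → suc (ℓ v) ≤ P
    ℓ<p v = proj₂ (ℓ.bounded v)

    label-bounds : ∀ e → P < K ∸ s e × K ∸ s e ≤ P + Q
    label-bounds e = complement-bounds a P Q (proj₁ (s.bounded e)) (proj₂ (s.bounded e))

    s≤K : ∀ e → s e ≤ K
    s≤K e = ≤-trans (<⇒≤ (proj₂ (s.bounded e))) (+-monoʳ-≤ a (m≤n+m Q P))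

    f-injective : Injective _≡_ _≡_ f
    f-injective {inj₁ v} {inj₁ w} eq = cong inj₁ (ℓ.injective (suc-injective eq))
    f-injective {inj₁ v} {inj₂ e} eq = ⊥-elim (<⇒≢ (≤-<-trans (ℓ<p v) (proj₁ (label-bounds e))) eq)
    f-injective {inj₂ e} {inj₁ v} eq = ⊥-elim (<⇒≢ (≤-<-trans (ℓ<p v) (proj₁ (label-bounds e))) (sym eq))
    f-injective {inj₂ e} {inj₂ e′} eq = cong inj₂ (s.injective (∸-cancelˡ-≡ (s≤K e) (s≤K e′) eq))

    vertexOnto : ∀ k → 1 ≤ k → k ≤ P → ∃ λ v → f (inj₁ v) ≡ k
    vertexOnto (suc k) _ k<P with ℓ.hits k z≤n k<P
    ... | v , refl = v , refl

    onto : ∀ k → 1 ≤ k → k ≤ P + Q → ∃ λ z → f z ≡ k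
    onto k 1≤k k≤P+Q with k ≤? P
    ... | yes k≤P = let v , fv≡k = vertexOnto k 1≤k k≤P in inj₁ v , fv≡k
    ... | no k≰P with complement-bounds⁻ a P Q (≰⇒> k≰P) k≤P+Q
    ...   | a≤K∸k , K∸k<a+Q with s.hits (K ∸ k) a≤K∸k K∸k<a+Q
    ...     | e , se≡K∸k =
      inj₂ e , trans (cong (K ∸_) se≡K∸k) (m∸[m∸n]≡n (≤-trans k≤P+Q (m≤n+m (P + Q) a)))

Loopless : Graph → Set
Loopless G = ∀ e → proj₁ (edge G e) ≢ proj₂ (edge G e)

distinct-sum-bounds : ∀ {x y N} → x ≢ y → 1 ≤ x → x ≤ N → 1 ≤ y → y ≤ N → 3 ≤ x + y × x + y < N + N
distinct-sum-bounds {x} {y} x≢y 1≤x x≤N 1≤y y≤N with <-cmp x y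
... | tri< x<y _ _ = +-mono-≤ 1≤x (≤-trans (s≤s 1≤x) x<y) , +-mono-<-≤ (<-≤-trans x<y y≤N) y≤N
... | tri≈ _ x≡y _ = ⊥-elim (x≢y x≡y)
... | tri> _ _ y<x = subst (3 ≤_) (+-comm y x) (+-mono-≤ 1≤y (≤-trans (s≤s 1≤y) y<x)) ,
                     +-mono-≤-< x≤N (<-≤-trans y<x x≤N)

superEdgeMagic⇒q≤2p∸3 : ∀ G → Loopless G → SuperEdgeMagic G → q G ≤ p G + p G ∸ 3
superEdgeMagic⇒q≤2p∸3 G loopless (f , sem) =
  bounded-injective⇒≤ (λ e → s e ∸ 3) (λ e → ∸-monoˡ-< (proj₂ (s-bounds e)) (proj₁ (s-bounds e)))
    λ {e} {e′} eq → s-injective (∸-cancelʳ-≡ (proj₁ (s-bounds e)) (proj₁ (s-bounds e′)) eq)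
  where
    open IsSuperEdgeMagic sem
    tail head : Fin (q G) → ℕ
    tail e = f (inj₁ (proj₁ (edge G e)))
    head e = f (inj₁ (proj₂ (edge G e)))
    s : Fin (q G) → ℕ
    s = edgeSum G (λ v → f (inj₁ v))

    s-bounds : ∀ e → 3 ≤ s e × s e < p G + p G
    s-bounds e = distinct-sum-bounds (λ eq → loopless e (inj₁-injective (injective eq)))
      (proj₁ (inRange (inj₁ u))) (vertexRange u) (proj₁ (inRange (inj₁ v))) (vertexRange v)
      where
        u = proj₁ (edge G e)
        v = proj₂ (edge G e)

    cancel-sides : ∀ x y z x′ y′ z′ → x + y + z ≡ x′ + y′ + z′ → x + z ≡ x′ + z′ → y ≡ y′
    cancel-sides x y z x′ y′ z′ eq₁ eq₂ = +-cancelʳ-≡ (x + z) y y′ (begin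
      y + (x + z)      ≡⟨ rearrange x y z ⟩
      x + y + z        ≡⟨ eq₁ ⟩
      x′ + y′ + z′     ≡⟨ rearrange x′ y′ z′ ⟨
      y′ + (x′ + z′)   ≡⟨ cong (y′ +_) eq₂ ⟨
      y′ + (x + z)     ∎)
      where
        open ≡-Reasoning
        rearrange : ∀ x y z → y + (x + z) ≡ x + y + z
        rearrange = solve-∀

    s-injective : Injective _≡_ _≡_ s
    s-injective {e} {e′} eq = inj₂-injective (injective
      (cancel-sides (tail e) (f (inj₂ e)) (head e) (tail e′) (f (inj₂ e′)) (head e′)
        (trans (proj₂ magic e) (sym (proj₂ magic e′))) eq))

length-concatMap-const : ∀ {A B : Set} (f : A → List B) k xs →
  (∀ x → length (f x) ≡ k) → length (concatMap f xs) ≡ length xs * k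
length-concatMap-const f k [] _ = refl
length-concatMap-const f k (x ∷ xs) |f|≡k =
  trans (length-++ (f x)) (cong₂ _+_ (|f|≡k x) (length-concatMap-const f k xs |f|≡k))

q-∪K₁ : ∀ G t → q (G ∪K₁[ t ]) ≡ q G
q-∪K₁ G t = length-map _ (edges G)

lift : ∀ {P} t → Fin P × Fin P → Fin (P + t) × Fin (P + t)
lift t uv = proj₁ uv ↑ˡ t , proj₂ uv ↑ˡ t

edge-∪K₁ : ∀ G t e → ∃ λ uv → uv ∈ edges G × edge (G ∪K₁[ t ]) e ≡ lift t uv
edge-∪K₁ G t e = ∈-map⁻ (lift t) (∈-lookup e)

∪K₁-edge : ∀ G t {uv} → uv ∈ edges G → ∃ λ e → edge (G ∪K₁[ t ]) e ≡ lift t uv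
∪K₁-edge G t uv∈ = ∈-edges⇒edge (G ∪K₁[ t ]) (∈-map⁺ (lift t) uv∈)

∪K₁-loopless : ∀ G t → (∀ {uv} → uv ∈ edges G → proj₁ uv ≢ proj₂ uv) → Loopless (G ∪K₁[ t ])
∪K₁-loopless G t no-loop e eq with edge-∪K₁ G t e
... | uv , uv∈ , e≡ =
  no-loop uv∈ (↑ˡ-injective t _ _ (trans (sym (cong proj₁ e≡)) (trans eq (cong proj₂ e≡))))

module K1n+Km-edges (n m : ℕ) where

  V : Set
  V = Fin (suc (n + m))

  c : V
  c = fzero

  x : Fin n → V
  x i = fsuc (i ↑ˡ m)

  y : Fin m → V
  y j = fsuc (n ↑ʳ j)

  data Edge : V × V → Set where
    c─x : ∀ i → Edge (c , x i)
    x─y : ∀ i j → Edge (x i , y j)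
    c─y : ∀ j → Edge (c , y j)

  row : Fin n → List (V × V)
  row i = map (λ j → x i , y j) (allFin m)

  cx-edges xy-edges cy-edges : List (V × V)
  cx-edges = map (λ i → c , x i) (allFin n)
  xy-edges = concatMap row (allFin n)
  cy-edges = map (λ j → c , y j) (allFin m)

  ∈-edges⁺ : ∀ {uv} → Edge uv → uv ∈ edges (K1n+Km n m)
  ∈-edges⁺ (c─x i) = ∈-++⁺ˡ (∈-map⁺ (λ i → c , x i) (∈-allFin i))
  ∈-edges⁺ (x─y i j) = ∈-++⁺ʳ cx-edges (∈-++⁺ˡ
    (∈-concat⁺′ (∈-map⁺ (λ j → x i , y j) (∈-allFin j)) (∈-map⁺ row (∈-allFin i))))
  ∈-edges⁺ (c─y j) = ∈-++⁺ʳ cx-edges (∈-++⁺ʳ xy-edges (∈-map⁺ (λ j → c , y j) (∈-allFin j)))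

  ∈-edges⁻ : ∀ {uv} → uv ∈ edges (K1n+Km n m) → Edge uv
  ∈-edges⁻ uv∈ with ∈-++⁻ cx-edges uv∈
  ... | inj₁ uv∈cx with ∈-map⁻ (λ i → c , x i) uv∈cx
  ...   | i , _ , refl = c─x i
  ∈-edges⁻ uv∈ | inj₂ uv∈xy++cy with ∈-++⁻ xy-edges uv∈xy++cy
  ... | inj₁ uv∈xy with ∈-concat⁻′ (map row (allFin n)) uv∈xy
  ...   | _ , uv∈row , row∈ with ∈-map⁻ row row∈
  ...     | i , _ , refl with ∈-map⁻ (λ j → x i , y j) uv∈row
  ...       | j , _ , refl = x─y i j
  ∈-edges⁻ uv∈ | inj₂ uv∈xy++cy | inj₂ uv∈cy with ∈-map⁻ (λ j → c , y j) uv∈cy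
  ... | j , _ , refl = c─y j

  q-K1n+Km : q (K1n+Km n m) ≡ n + (n * m + m)
  q-K1n+Km = trans (length-++ cx-edges) (cong₂ _+_ (length-map-allFin n)
    (trans (length-++ xy-edges) (cong₂ _+_ |xy-edges| (length-map-allFin m))))
    where
      length-allFin : ∀ k → length (allFin k) ≡ k
      length-allFin k = length-tabulate {n = k} (λ i → i)
      length-map-allFin : ∀ k {g : Fin k → V × V} → length (map g (allFin k)) ≡ k
      length-map-allFin k {g} = trans (length-map g (allFin k)) (length-allFin k)
      |xy-edges| : length xy-edges ≡ n * m
      |xy-edges| = trans (length-concatMap-const row m (allFin n) (λ _ → length-map-allFin m))
                         (cong (_* m) (length-allFin n))

  x≢y : ∀ i j → x i ≢ y j
  x≢y i j eq with trans (sym (splitAt-↑ˡ n i m))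
                       (trans (cong (splitAt n) (fsuc-injective eq)) (splitAt-↑ʳ n m j))
  ... | ()

  Edge⇒distinct : ∀ {u v} → Edge (u , v) → u ≢ v
  Edge⇒distinct (c─x i) ()
  Edge⇒distinct (x─y i j) = x≢y i j
  Edge⇒distinct (c─y j) ()

ceilHalf-least : ∀ {a t} → a ≤ 2 * t → ceilHalf a ≤ t
ceilHalf-least {a} {t} a≤2t = ≤-pred (m<n*o⇒m/o<n {a + 1} {suc t} {2} a+1<2[t+1])
  where
    a+1<2[t+1] : a + 1 < suc t * 2
    a+1<2[t+1] = s≤s (subst (_≤ suc (t * 2)) (+-comm 1 a) (s≤s (subst (a ≤_) (*-comm 2 t) a≤2t)))

q≤2p∸3⇒deficiency-bound : ∀ n m t →
  n + (n * m + m) ≤ suc (n + m) + t + (suc (n + m) + t) ∸ 3 → (n ∸ 1) * (m ∸ 1) ≤ 2 * t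
q≤2p∸3⇒deficiency-bound zero m t _ = z≤n
q≤2p∸3⇒deficiency-bound (suc a) zero t _ = subst (_≤ 2 * t) (sym (*-zeroʳ a)) z≤n
q≤2p∸3⇒deficiency-bound (suc a) (suc b) t q≤2p∸3 =
  +-cancelʳ-≤ slack (a * b) (2 * t) (subst₂ _≤_ (q≡ a b) p∸3≡ q≤2p∸3)
  where
    slack = 2 * a + 2 * b + 3
    q≡ : ∀ a b → suc a + (suc a * suc b + suc b) ≡ a * b + (2 * a + 2 * b + 3)
    q≡ = solve-∀
    2p≡ : ∀ a b t → suc (suc a + suc b) + t + (suc (suc a + suc b) + t) ≡ 2 * t + (2 * a + 2 * b + 3) + 3
    2p≡ = solve-∀
    p∸3≡ : suc (suc a + suc b) + t + (suc (suc a + suc b) + t) ∸ 3 ≡ 2 * t + slack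
    p∸3≡ = trans (cong (_∸ 3) (2p≡ a b t)) (m+n∸n≡m (2 * t + slack) 3)

deficiency-lower-bound : ∀ n m t → SuperEdgeMagic (K1n+Km n m ∪K₁[ t ]) → (n ∸ 1) * (m ∸ 1) ≤ 2 * t
deficiency-lower-bound n m t sem = q≤2p∸3⇒deficiency-bound n m t
  (subst (_≤ p G + p G ∸ 3) (trans (q-∪K₁ (K1n+Km n m) t) q-K1n+Km)
    (superEdgeMagic⇒q≤2p∸3 G (∪K₁-loopless (K1n+Km n m) t (λ uv∈ → Edge⇒distinct (∈-edges⁻ uv∈))) sem))
  where
    open K1n+Km-edges n m
    G = K1n+Km n m ∪K₁[ t ]

row-major-< : ∀ {d A B M} → A < M → B < d → A * d + B < M * d
row-major-< {d} {A} {B} {M} A<M B<d = begin-strict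
  A * d + B   <⟨ +-monoʳ-< (A * d) B<d ⟩
  A * d + d   ≡⟨ +-comm (A * d) d ⟩
  suc A * d   ≤⟨ *-monoˡ-≤ d A<M ⟩
  M * d       ∎
  where open ≤-Reasoning

row-major-% : ∀ {d} .{{_ : NonZero d}} A {B} → B < d → (A * d + B) % d ≡ B
row-major-% {d} A {B} B<d =
  trans (%-congˡ (+-comm (A * d) B)) (trans ([m+kn]%n≡m%n B A d) (m<n⇒m%n≡m B<d))

row-major-/ : ∀ {d} .{{_ : NonZero d}} A {B} → B < d → (A * d + B) / d ≡ A
row-major-/ {d} A {B} B<d = *-cancelʳ-≡ (w / d) A d (+-cancelˡ-≡ B _ _ (begin
  B + w / d * d       ≡⟨ cong (_+ w / d * d) (row-major-% A B<d) ⟨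
  w % d + w / d * d   ≡⟨ m≡m%n+[m/n]*n w d ⟨
  A * d + B           ≡⟨ +-comm (A * d) B ⟩
  B + A * d           ∎))
  where
    open ≡-Reasoning
    w = A * d + B

<*⇒row-major : ∀ {d M} .{{_ : NonZero d}} w → w < M * d → ∃₂ λ A B → A < M × B < d × w ≡ A * d + B
<*⇒row-major {d} w w<Md =
  w / d , w % d , m<n*o⇒m/o<n w<Md , m%n<n w d , trans (m≡m%n+[m/n]*n w d) (+-comm (w % d) (w / d * d))

-- Labels minus one are the cells (A , B) ↦ A (n+1) + B of an m × (n+1) grid:
-- y₀ = (0,0), xᵢ = (0,i+1), c = (1,0), yⱼ = (j,n) for j ≥ 1, and the t isolated vertices fill
-- rows 1 … m−1, columns 0 … n−1 except (1,0). The edge sums then occupy every cell of the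
-- (m+1) × (n+1) grid except (0,0), i.e. they are exactly 1 … (m+1)(n+1) − 1.
module Construction (n₀ m₀ : ℕ) where

  n m₁ m d t : ℕ
  n = suc n₀
  m₁ = suc m₀
  m = suc m₁
  d = suc n
  t = n * m₁ ∸ 1

  open K1n+Km-edges n m

  G : Graph
  G = K1n+Km n m ∪K₁[ t ]

  cell : ℕ → ℕ → ℕ
  cell A B = A * d + B

  posY : Fin m → ℕ
  posY fzero = cell 0 0
  posY (fsuc j) = cell (suc (toℕ j)) n

  posK : V → ℕ
  posK fzero = cell 1 0
  posK (fsuc w) = [ (λ i → cell 0 (suc (toℕ i))) , posY ]′ (splitAt n w)

  posIso : Fin t → ℕ
  posIso k = cell (suc (r / n)) (r % n)
    where r = suc (toℕ k)

  pos : Fin (p G) → ℕ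
  pos v = [ posK , posIso ]′ (splitAt (suc (n + m)) v)

  pos-↑ˡ : ∀ u → pos (u ↑ˡ t) ≡ posK u
  pos-↑ˡ u = cong [ posK , posIso ]′ (splitAt-↑ˡ (suc (n + m)) u t)

  pos-↑ʳ : ∀ k → pos (suc (n + m) ↑ʳ k) ≡ posIso k
  pos-↑ʳ k = cong [ posK , posIso ]′ (splitAt-↑ʳ (suc (n + m)) t k)

  posK-x : ∀ i → posK (x i) ≡ suc (toℕ i)
  posK-x i = cong [ (λ i → cell 0 (suc (toℕ i))) , posY ]′ (splitAt-↑ˡ n i m)

  posK-y : ∀ j → posK (y j) ≡ posY j
  posK-y j = cong [ (λ i → cell 0 (suc (toℕ i))) , posY ]′ (splitAt-↑ʳ n m j)

  p≡m*d : p G ≡ m * d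
  p≡m*d = count n₀ m₀
    where
      count : ∀ n₀ m₀ → suc (suc n₀ + suc (suc m₀)) + (m₀ + n₀ * suc m₀) ≡ suc (suc m₀) * suc (suc n₀)
      count = solve-∀

  1+q≡[m+1]*d : suc (q G) ≡ suc m * d
  1+q≡[m+1]*d = trans (cong suc (trans (q-∪K₁ (K1n+Km n m) t) q-K1n+Km)) (count n m)
    where
      count : ∀ n m → suc (n + (n * m + m)) ≡ suc m * suc n
      count = solve-∀

  cell-< : ∀ A B → A < m → B < d → cell A B < m * d
  cell-< A B = row-major-< {d} {A} {B} {m}

  posK-< : ∀ u → posK u < m * d
  posK-< fzero = cell-< 1 0 (s≤s (s≤s z≤n)) (s≤s z≤n)
  posK-< (fsuc w) with splitAt n w
  ... | inj₁ i = cell-< 0 (suc (toℕ i)) (s≤s z≤n) (s≤s (toℕ<n i))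
  ... | inj₂ fzero = cell-< 0 0 (s≤s z≤n) (s≤s z≤n)
  ... | inj₂ (fsuc j) = cell-< (suc (toℕ j)) n (s≤s (toℕ<n j)) ≤-refl

  posIso-< : ∀ k → posIso k < m * d
  posIso-< k = cell-< (suc (r / n)) (r % n)
    (s≤s (m<n*o⇒m/o<n (subst (r <_) (*-comm n m₁) (s≤s (toℕ<n k)))))
    (m<n⇒m<1+n (m%n<n r n))
    where r = suc (toℕ k)

  pos-< : ∀ v → pos v < m * d
  pos-< v with splitAt (suc (n + m)) v
  ... | inj₁ u = posK-< u
  ... | inj₂ k = posIso-< k

  isolated-at : ∀ A B r → A < m₁ → B < n → suc r ≡ A * n + B → ∃ λ v → pos v ≡ cell (suc A) B
  isolated-at A B r A<m₁ B<n r+1≡ = suc (n + m) ↑ʳ k , (begin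
    pos (suc (n + m) ↑ʳ k)                        ≡⟨ pos-↑ʳ k ⟩
    cell (suc (suc (toℕ k) / n)) (suc (toℕ k) % n) ≡⟨ cong (λ r → cell (suc (r / n)) (r % n)) index≡ ⟩
    cell (suc ((A * n + B) / n)) ((A * n + B) % n)
      ≡⟨ cong₂ (λ a b → cell (suc a) b) (row-major-/ A B<n) (row-major-% A B<n) ⟩
    cell (suc A) B                                ∎)
    where
      open ≡-Reasoning
      r<t : r < t
      r<t = ≤-pred (subst (suc r <_) (*-comm m₁ n)
              (subst (_< m₁ * n) (sym r+1≡) (row-major-< {n} {A} {B} {m₁} A<m₁ B<n)))
      k = fromℕ< r<t
      index≡ : suc (toℕ k) ≡ A * n + B
      index≡ = trans (cong suc (toℕ-fromℕ< r<t)) r+1≡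

  interior-at : ∀ A B → A < m₁ → B < n → ∃ λ v → pos v ≡ cell (suc A) B
  interior-at zero zero _ _ = c ↑ˡ t , pos-↑ˡ c
  interior-at zero (suc B) A<m₁ B<n = isolated-at zero (suc B) B A<m₁ B<n refl
  interior-at (suc A) B A<m₁ B<n = isolated-at (suc A) B (n₀ + A * n + B) A<m₁ B<n refl

  vertex-at : ∀ A B → A < m → B < d → ∃ λ v → pos v ≡ cell A B
  vertex-at zero zero _ _ = y fzero ↑ˡ t , trans (pos-↑ˡ (y fzero)) (posK-y fzero)
  vertex-at zero (suc B) _ (s≤s B<n) =
    x i ↑ˡ t , trans (pos-↑ˡ (x i)) (trans (posK-x i) (cong suc (toℕ-fromℕ< B<n)))
    where i = fromℕ< B<n
  vertex-at (suc A) B (s≤s A<m₁) B<d with m<1+n⇒m<n∨m≡n B<d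
  ... | inj₁ B<n = interior-at A B A<m₁ B<n
  ... | inj₂ refl =
    y j ↑ˡ t , trans (pos-↑ˡ (y j)) (trans (posK-y j) (cong (λ a → cell (suc a) n) (toℕ-fromℕ< A<m₁)))
    where j = fsuc (fromℕ< A<m₁)

  pos-enumerates : Enumerates 0 pos
  pos-enumerates = record
    { bounded = λ v → z≤n , subst (pos v <_) (sym p≡m*d) (pos-< v)
    ; hits    = hits
    }
    where
      hits : ∀ w → 0 ≤ w → w < p G → ∃ λ v → pos v ≡ w
      hits w _ w<p with <*⇒row-major {d} {m} w (subst (w <_) p≡m*d w<p)
      ... | A , B , A<m , B<d , refl = vertex-at A B A<m B<d

  S : V × V → ℕ
  S = pairSum posK

  S-c─x : ∀ i → S (c , x i) ≡ cell 1 (suc (toℕ i))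
  S-c─x i = trans (cong (cell 1 0 +_) (posK-x i)) (cong (_+ suc (toℕ i)) (+-identityʳ (1 * d)))

  S-x─y₀ : ∀ i → S (x i , y fzero) ≡ cell 0 (suc (toℕ i))
  S-x─y₀ i = trans (cong₂ _+_ (posK-x i) (posK-y fzero)) (+-identityʳ (suc (toℕ i)))

  S-x─y : ∀ i j → S (x i , y (fsuc j)) ≡ cell (2 + toℕ j) (toℕ i)
  S-x─y i j = trans (cong₂ _+_ (posK-x i) (posK-y (fsuc j))) (shift n (toℕ i) (toℕ j))
    where
      shift : ∀ n i j → suc i + (suc j * suc n + n) ≡ suc (suc j) * suc n + i
      shift = solve-∀

  S-c─y₀ : S (c , y fzero) ≡ cell 1 0
  S-c─y₀ = trans (cong (cell 1 0 +_) (posK-y fzero)) (+-identityʳ (cell 1 0))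

  S-c─y : ∀ j → S (c , y (fsuc j)) ≡ cell (2 + toℕ j) n
  S-c─y j = trans (cong (cell 1 0 +_) (posK-y (fsuc j))) (shift n (toℕ j))
    where
      shift : ∀ n j → 1 * suc n + 0 + (suc j * suc n + n) ≡ suc (suc j) * suc n + n
      shift = solve-∀

  S-bounds : ∀ {uv} → Edge uv → 1 ≤ S uv × S uv < suc m * d
  S-bounds (c─x i) rewrite S-c─x i =
    s≤s z≤n , row-major-< {d} {1} {suc (toℕ i)} {suc m} (s≤s (s≤s z≤n)) (s≤s (toℕ<n i))
  S-bounds (x─y i fzero) rewrite S-x─y₀ i =
    s≤s z≤n , row-major-< {d} {0} {suc (toℕ i)} {suc m} (s≤s z≤n) (s≤s (toℕ<n i))
  S-bounds (x─y i (fsuc j)) rewrite S-x─y i j =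
    s≤s z≤n , row-major-< {d} {2 + toℕ j} {toℕ i} {suc m} (s≤s (s≤s (toℕ<n j))) (m<n⇒m<1+n (toℕ<n i))
  S-bounds (c─y fzero) rewrite S-c─y₀ =
    s≤s z≤n , row-major-< {d} {1} {0} {suc m} (s≤s (s≤s z≤n)) (s≤s z≤n)
  S-bounds (c─y (fsuc j)) rewrite S-c─y j =
    s≤s z≤n , row-major-< {d} {2 + toℕ j} {n} {suc m} (s≤s (s≤s (toℕ<n j))) ≤-refl

  edge-at : ∀ A B → A < suc m → B < d → 1 ≤ cell A B → ∃ λ uv → Edge uv × S uv ≡ cell A B
  edge-at zero (suc B) _ (s≤s B<n) _ =
    (x i , y fzero) , x─y i fzero , trans (S-x─y₀ i) (cong suc (toℕ-fromℕ< B<n))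
    where i = fromℕ< B<n
  edge-at 1 zero _ _ _ = (c , y fzero) , c─y fzero , S-c─y₀
  edge-at 1 (suc B) _ (s≤s B<n) _ =
    (c , x i) , c─x i , trans (S-c─x i) (cong (λ b → cell 1 (suc b)) (toℕ-fromℕ< B<n))
    where i = fromℕ< B<n
  edge-at (suc (suc A)) B (s≤s (s≤s A<m₁)) B<d _ with m<1+n⇒m<n∨m≡n B<d
  ... | inj₁ B<n = (x i , y j) , x─y i j ,
    trans (S-x─y i (fromℕ< A<m₁)) (cong₂ (λ a b → cell (2 + a) b) (toℕ-fromℕ< A<m₁) (toℕ-fromℕ< B<n))
    where i = fromℕ< B<n
          j = fsuc (fromℕ< A<m₁)
  ... | inj₂ refl =
    (c , y j) , c─y j , trans (S-c─y (fromℕ< A<m₁)) (cong (λ a → cell (2 + a) n) (toℕ-fromℕ< A<m₁))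
    where j = fsuc (fromℕ< A<m₁)

  pairSum-lift : ∀ uv → pairSum pos (lift t uv) ≡ S uv
  pairSum-lift uv = cong₂ _+_ (pos-↑ˡ (proj₁ uv)) (pos-↑ˡ (proj₂ uv))

  edgeSum≡S : ∀ e → ∃ λ uv → Edge uv × edgeSum G pos e ≡ S uv
  edgeSum≡S e with edge-∪K₁ (K1n+Km n m) t e
  ... | uv , uv∈ , e≡ = uv , ∈-edges⁻ uv∈ , trans (cong (pairSum pos) e≡) (pairSum-lift uv)

  S≡edgeSum : ∀ {uv} → Edge uv → ∃ λ e → edgeSum G pos e ≡ S uv
  S≡edgeSum {uv} E with ∪K₁-edge (K1n+Km n m) t (∈-edges⁺ E)
  ... | e , e≡ = e , trans (cong (pairSum pos) e≡) (pairSum-lift uv)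

  edgeSum-enumerates : Enumerates 1 (edgeSum G pos)
  edgeSum-enumerates = record { bounded = bounded ; hits = hits }
    where
      bounded : ∀ e → 1 ≤ edgeSum G pos e × edgeSum G pos e < suc (q G)
      bounded e with edgeSum≡S e
      ... | uv , E , s≡ rewrite s≡ | 1+q≡[m+1]*d = S-bounds E
      hits : ∀ w → 1 ≤ w → w < suc (q G) → ∃ λ e → edgeSum G pos e ≡ w
      hits w 1≤w w<1+q with <*⇒row-major {d} {suc m} w (subst (w <_) 1+q≡[m+1]*d w<1+q)
      ... | A , B , A<m+1 , B<d , refl with edge-at A B A<m+1 B<d 1≤w
      ...   | uv , E , S≡ with S≡edgeSum E
      ...     | e , s≡ = e , trans s≡ S≡

  superEdgeMagic : SuperEdgeMagic G
  superEdgeMagic = consecutive-edgeSums⇒superEdgeMagic G pos 1 pos-enumerates edgeSum-enumerates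

-- Both bounds hold for n = 1 as well.
theorem4 : ∀ (n m : ℕ) → 2 ≤ n → 2 ≤ m →
    ≤μs (ceilHalf ((n ∸ 1) * (m ∸ 1))) (K1n+Km n m)
      × μs≤ (K1n+Km n m) (n * (m ∸ 1) ∸ 1)
theorem4 n@(suc n₀) m@(suc (suc m₀)) _ (s≤s (s≤s _)) =
  (λ t t<⌈⌉ sem → <⇒≱ t<⌈⌉ (ceilHalf-least (deficiency-lower-bound n m t sem))) ,
  (n * (m ∸ 1) ∸ 1 , ≤-refl , Construction.superEdgeMagic n₀ m₀)
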